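{- Let $(p_k)_{k\ge1}$ be a sequence of positive integers. In the flashcard game with insertion sequence $(p_k)$, every card is seen infinitely often if and only if the sequence $(p_k)$ is unbounded.
   Context: Let $(p_k)_{k\ge1}$ be a sequence of positive integers (the insertion sequence). The flashcard game with insertion sequence $(p_k)$ is the following deterministic process. The state at each time $t=1,2,\dots$ consists of an ordering (the deck) of all positive integers (cards), positions numbered $1,2,\dots$ from the front, together with a counter for each card recording how many times it has been seen. At time $t=1$ the deck is $1,2,3,\dots$, card $1$ (at the front) has been seen once, and all other cards $0$ times. To pass from time $t$ to $t+1$: if the front card has been seen $k$ times so far, remove it and reinsert it so that it occupies position $p_k$; then the card now at the front has its counter increased by one (it is seen at time $t+1$). -}

module Defs where

open import Data.Nat using (ℕ; zero; suc; _∸_; _<ᵇ_; _≡ᵇ_; _≤_; _<_)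
open import Data.Bool using (Bool; true; false; if_then_else_)
open import Data.Product using (Σ; _×_; ∃-syntax)
open import Relation.Binary.PropositionalEquality using (_≡_)

-- Conventions: positions in the deck are 0-indexed (paper position j is
-- index j ∸ 1 here); cards are the positive integers 1,2,3,...;
-- time is 0-indexed (paper time t is index t ∸ 1 here).
-- The insertion sequence is p : ℕ → ℕ with p k = p_k for k ≥ 1 (p 0 unused).

record State : Set where
  field
    deck : ℕ → ℕ
    seen : ℕ → ℕ

open State public

initial : State
deck initial i = suc i
seen initial c = if c ≡ᵇ 1 then 1 else 0

-- remove the front card and reinsert it at (1-indexed) position p_k,
-- where k = its counter; then the new front card is seen once more.
moveFront : ℕ → (ℕ → ℕ) → ℕ → ℕ
moveFront q d i =
  if i <ᵇ q then d (suc i) else (if i ≡ᵇ q then d 0 else d i)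

step : (ℕ → ℕ) → State → State
step p s = record { deck = d' ; seen = cnt' }
  where
    k : ℕ
    k = seen s (deck s 0)
    d' : ℕ → ℕ
    d' = moveFront (p k ∸ 1) (deck s)
    cnt' : ℕ → ℕ
    cnt' c = if c ≡ᵇ d' 0 then suc (seen s c) else seen s c

game : (ℕ → ℕ) → ℕ → State
game p zero    = initial
game p (suc t) = step p (game p t)

SeenAt : (ℕ → ℕ) → ℕ → ℕ → Set
SeenAt p c t = deck (game p t) 0 ≡ c

EveryCardSeenInfinitelyOften : (ℕ → ℕ) → Set
EveryCardSeenInfinitelyOften p =
  ∀ c → 1 ≤ c → ∀ N → ∃[ t ] (N ≤ t × SeenAt p c t)

Unbounded : (ℕ → ℕ) → Set
Unbounded p = ∀ B → ∃[ k ] (1 ≤ k × B < p k)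

module Submission where

-- If p_k ≤ B for all k, every insertion lands in the first B+1 positions, which
-- therefore only ever hold the cards 1,…,B+1: card B+2 is never seen.
-- Conversely let p be unbounded and card c sit at position j+1. As long as it stays
-- there, the cards in front of it are the j+1 cards that were there at the start, and
-- each step raises one of their counters. Pick K larger than their initial total with
-- p_K > j+1. The counters cannot all stay below K forever, and the first time one of
-- these cards is seen for the K-th time it is reinserted behind c, so c moves forward.

open import Defs
open import Data.Nat using (ℕ; zero; suc; _+_; _*_; _∸_; _⊔_; _≤_; _<_; z≤n; s≤s; z<s; _≤?_; _<?_; _<ᵇ_; _≡ᵇ_)
open import Data.Nat.Properties
open import Data.Nat.ListAction using (sum)
open import Data.Bool using (true; false)
open import Data.Unit using (tt)
open import Data.List using (List; []; _∷_; map; length; applyUpTo)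
open import Data.List.Relation.Unary.Any using (here; there)
open import Data.List.Membership.Propositional using (_∈_)
open import Data.List.Membership.Propositional.Properties using (∈-applyUpTo⁺)
open import Data.Product using (_×_; _,_; ∃-syntax; proj₁; proj₂)
open import Data.Sum using (_⊎_; inj₁; inj₂)
open import Function using (_∘′_)
open import Function.Bundles using (_⇔_; mk⇔)
open import Relation.Nullary using (contradiction; yes; no)
open import Relation.Nullary.Reflects using (ofʸ; ofⁿ)
open import Relation.Binary.Definitions using (tri<; tri≈; tri>)
open import Relation.Binary.PropositionalEquality

moveFront-< : ∀ q d {i} → i < q → moveFront q d i ≡ d (suc i)
moveFront-< q d {i} i<q with i <ᵇ q | <ᵇ-reflects-< i q
... | true  | _       = refl
... | false | ofⁿ i≮q = contradiction i<q i≮q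

moveFront-≡ : ∀ q d → moveFront q d q ≡ d 0
moveFront-≡ q d with q <ᵇ q | <ᵇ-reflects-< q q | q ≡ᵇ q | ≡⇒≡ᵇ q q refl
... | true  | ofʸ q<q | _    | _ = contradiction q<q (n≮n q)
... | false | _       | true | _ = refl

moveFront-> : ∀ q d {i} → q < i → moveFront q d i ≡ d i
moveFront-> q d {i} q<i with i <ᵇ q | <ᵇ-reflects-< i q | i ≡ᵇ q | ≡ᵇ⇒≡ i q
... | true  | ofʸ i<q | _     | _   = contradiction i<q (<⇒≯ q<i)
... | false | _       | true  | i≡q = contradiction (i≡q tt) (>⇒≢ q<i)
... | false | _       | false | _   = refl

moveFront-prefix : ∀ {P : ℕ → Set} {q n} d → q < n → (∀ i → i < n → P (d i)) →
                   ∀ i → i < n → P (moveFront q d i)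
moveFront-prefix {P} {q} d q<n Pd i i<n with <-cmp i q
... | tri< i<q _ _ = subst P (sym (moveFront-< q d i<q)) (Pd (suc i) (≤-<-trans i<q q<n))
... | tri≈ _ refl _ = subst P (sym (moveFront-≡ q d)) (Pd 0 (≤-<-trans z≤n q<n))
... | tri> _ _ q<i = subst P (sym (moveFront-> q d q<i)) (Pd i i<n)

module _ {A : Set} where

  sum-map-mono : ∀ {f g : A → ℕ} xs → (∀ x → f x ≤ g x) → sum (map f xs) ≤ sum (map g xs)
  sum-map-mono []       f≤g = z≤n
  sum-map-mono (x ∷ xs) f≤g = +-mono-≤ (f≤g x) (sum-map-mono xs f≤g)

  sum-map-strict : ∀ {f g : A → ℕ} {y xs} → (∀ x → f x ≤ g x) → y ∈ xs → f y < g y →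
                   sum (map f xs) < sum (map g xs)
  sum-map-strict {xs = x ∷ xs} f≤g (here refl) fy<gy = +-mono-<-≤ fy<gy (sum-map-mono xs f≤g)
  sum-map-strict {xs = x ∷ xs} f≤g (there y∈xs) fy<gy =
    +-mono-≤-< (f≤g x) (sum-map-strict f≤g y∈xs fy<gy)

  ∈⇒≤sum-map : ∀ {f : A → ℕ} {y xs} → y ∈ xs → f y ≤ sum (map f xs)
  ∈⇒≤sum-map {f} {xs = x ∷ xs} (here refl)  = m≤m+n (f x) _
  ∈⇒≤sum-map {f} {xs = x ∷ xs} (there y∈xs) = ≤-trans (∈⇒≤sum-map y∈xs) (m≤n+m _ (f x))

  sum-map-≤-length* : ∀ {f : A → ℕ} {K} xs → (∀ {x} → x ∈ xs → f x ≤ K) →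
                      sum (map f xs) ≤ length xs * K
  sum-map-≤-length* []       f≤K = z≤n
  sum-map-≤-length* (x ∷ xs) f≤K =
    +-mono-≤ (f≤K (here refl)) (sum-map-≤-length* xs (f≤K ∘′ there))

bounded-potential : ∀ {Good Done : ℕ → Set} (Φ : ℕ → ℕ) {bound} →
  (∀ t → Good t → Φ t ≤ bound) →
  (∀ t → Good t → Done t ⊎ (Good (suc t) × Φ t < Φ (suc t))) →
  ∀ {N} → Good N → ∃[ t ] (N ≤ t × Done t)
bounded-potential {Good} {Done} Φ {bound} Φ≤bound step {N} goodN
  with climb (suc bound)
  where
    climb : ∀ n → ∃[ t ] (N ≤ t × Done t) ⊎ (Good (n + N) × n + Φ N ≤ Φ (n + N))
    climb zero = inj₂ (goodN , ≤-refl)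
    climb (suc n) with climb n
    ... | inj₁ done = inj₁ done
    ... | inj₂ (good , rise) with step (n + N) good
    ...   | inj₁ done = inj₁ (n + N , m≤n+m N n , done)
    ...   | inj₂ (good′ , Φ<) = inj₂ (good′ , ≤-trans (s≤s rise) Φ<)
... | inj₁ done = done
... | inj₂ (good , rise) =
  contradiction (≤-trans (m≤m+n (suc bound) (Φ N)) (≤-trans rise (Φ≤bound _ good))) (n≮n bound)

unbounded-beyond : ∀ {p} → Unbounded p → ∀ M B → ∃[ k ] (M < k × B < p k)
unbounded-beyond unb zero    B = unb B
unbounded-beyond {p} unb (suc M) B with unbounded-beyond unb M (B ⊔ p (suc M))
... | k , M<k , B⊔pM<pk = k , ≤∧≢⇒< M<k k≢1+M , ≤-<-trans (m≤m⊔n B _) B⊔pM<pk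
  where
    k≢1+M : suc M ≢ k
    k≢1+M refl = n≮n (p k) (≤-<-trans (m≤n⊔m B (p k)) B⊔pM<pk)

front : State → ℕ
front s = deck s 0

insertionIndex : (ℕ → ℕ) → State → ℕ
insertionIndex p s = p (seen s (front s)) ∸ 1

module _ (p : ℕ → ℕ) (s : State) where

  seen-step-front : seen (step p s) (front (step p s)) ≡ suc (seen s (front (step p s)))
  seen-step-front with front (step p s) ≡ᵇ front (step p s) | ≡⇒≡ᵇ (front (step p s)) _ refl
  ... | true | _ = refl

  seen-step-other : ∀ {x} → x ≢ front (step p s) → seen (step p s) x ≡ seen s x
  seen-step-other {x} x≢f with x ≡ᵇ front (step p s) | ≡ᵇ⇒≡ x (front (step p s))
  ... | true  | x≡f = contradiction (x≡f _) x≢f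
  ... | false | _   = refl

  seen-step-mono : ∀ x → seen s x ≤ seen (step p s) x
  seen-step-mono x with x ≟ front (step p s)
  ... | yes refl = ≤-trans (n≤1+n _) (≤-reflexive (sym seen-step-front))
  ... | no x≢f   = ≤-reflexive (sym (seen-step-other x≢f))

module _ (p : ℕ → ℕ) where

  front-seen-positive : ∀ t → 1 ≤ seen (game p t) (front (game p t))
  front-seen-positive zero    = s≤s z≤n
  front-seen-positive (suc t) = ≤-trans (s≤s z≤n) (≤-reflexive (sym (seen-step-front p (game p t))))

  card-in-deck : ∀ t c → 1 ≤ c → ∃[ i ] (deck (game p t) i ≡ c)
  card-in-deck zero (suc c) _ = c , refl
  card-in-deck (suc t) c 1≤c with card-in-deck t c 1≤c
  ... | zero , at = q , trans (moveFront-≡ q (deck (game p t))) at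
    where q = insertionIndex p (game p t)
  ... | suc i , at with suc i ≤? insertionIndex p (game p t)
  ...   | yes i<q = i , trans (moveFront-< _ (deck (game p t)) i<q) at
  ...   | no  i≮q = suc i , trans (moveFront-> _ (deck (game p t)) (≰⇒> i≮q)) at

  large-insertion-or-prefix-bounded : ∀ B t →
    ∃[ k ] (1 ≤ k × B < p k) ⊎ (∀ i → i < suc B → deck (game p t) i ≤ suc B)
  large-insertion-or-prefix-bounded B zero = inj₂ (λ i i<1+B → i<1+B)
  large-insertion-or-prefix-bounded B (suc t) with large-insertion-or-prefix-bounded B t
  ... | inj₁ large = inj₁ large
  ... | inj₂ bounded with B <? p (seen (game p t) (front (game p t)))
  ...   | yes B<pk = inj₁ (_ , front-seen-positive t , B<pk)
  ...   | no  B≮pk = inj₂ (moveFront-prefix {P = _≤ suc B} (deck (game p t)) q<1+B bounded)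
    where q<1+B = s≤s (≤-trans (m∸n≤m _ 1) (≮⇒≥ B≮pk))

  seenInfinitelyOften⇒unbounded : EveryCardSeenInfinitelyOften p → Unbounded p
  seenInfinitelyOften⇒unbounded everySeen B with everySeen (suc (suc B)) (s≤s z≤n) 0
  ... | t , _ , seenAt with large-insertion-or-prefix-bounded B t
  ...   | inj₁ large   = large
  ...   | inj₂ bounded = contradiction (subst (_≤ suc B) seenAt (bounded 0 z<s)) (n≮n (suc B))

module Advance (p : ℕ → ℕ) (unbounded : Unbounded p) {N j c : ℕ}
               (c-at : deck (game p N) (suc j) ≡ c) where

  window : List ℕ
  window = applyUpTo (deck (game p N)) (suc j)

  total : ℕ → ℕ
  total t = sum (map (seen (game p t)) window)

  K-choice : ∃[ k ] (total N < k × suc j < p k)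
  K-choice = unbounded-beyond unbounded (total N) (suc j)

  K : ℕ
  K = proj₁ K-choice

  total<K : total N < K
  total<K = proj₁ (proj₂ K-choice)

  K-inserts-behind : suc j ≤ p K ∸ 1
  K-inserts-behind = ∸-monoˡ-≤ 1 (proj₂ (proj₂ K-choice))

  -- Only the front card may have been seen K times; it is then reinserted behind c.
  record Trapped (t : ℕ) : Set where
    field
      card-at   : deck (game p t) (suc j) ≡ c
      prefix⊆   : ∀ i → i < suc j → deck (game p t) i ∈ window
      front≤K   : seen (game p t) (front (game p t)) ≤ K
      others<K  : ∀ {x} → x ∈ window → x ≢ front (game p t) → seen (game p t) x < K

  AdvancesAt : ℕ → Set
  AdvancesAt t = deck (game p (suc t)) j ≡ c

  trapped-initially : Trapped N
  trapped-initially = record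
    { card-at  = c-at
    ; prefix⊆  = λ i i<1+j → ∈-applyUpTo⁺ (deck (game p N)) i<1+j
    ; front≤K  = <⇒≤ (below (∈-applyUpTo⁺ (deck (game p N)) z<s))
    ; others<K = λ x∈w _ → below x∈w
    }
    where
      below : ∀ {x} → x ∈ window → seen (game p N) x < K
      below x∈w = ≤-<-trans (∈⇒≤sum-map x∈w) total<K

  module _ (t : ℕ) (trapped : Trapped t) where
    open Trapped trapped

    seen≤K : ∀ {x} → x ∈ window → seen (game p t) x ≤ K
    seen≤K {x} x∈w with x ≟ front (game p t)
    ... | yes refl = front≤K
    ... | no  x≢f  = <⇒≤ (others<K x∈w x≢f)

    total≤ : total t ≤ length window * K
    total≤ = sum-map-≤-length* window seen≤K

    module _ (q<1+j : insertionIndex p (game p t) < suc j) where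

      seen<K : ∀ {x} → x ∈ window → seen (game p t) x < K
      seen<K {x} x∈w with x ≟ front (game p t)
      ... | yes refl = ≤∧≢⇒< front≤K λ k≡K →
                         <⇒≱ q<1+j (subst (λ k → suc j ≤ p k ∸ 1) (sym k≡K) K-inserts-behind)
      ... | no  x≢f  = others<K x∈w x≢f

      prefix′ : ∀ i → i < suc j → deck (game p (suc t)) i ∈ window
      prefix′ = moveFront-prefix {P = _∈ window} (deck (game p t)) q<1+j prefix⊆

      stays-trapped : Trapped (suc t)
      stays-trapped = record
        { card-at  = trans (moveFront-> _ (deck (game p t)) q<1+j) card-at
        ; prefix⊆  = prefix′
        ; front≤K  = subst (_≤ K) (sym (seen-step-front p (game p t))) (seen<K (prefix′ 0 z<s))
        ; others<K = λ x∈w x≢f′ → subst (_< K) (sym (seen-step-other p (game p t) x≢f′)) (seen<K x∈w)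
        }

      total-increases : total t < total (suc t)
      total-increases = sum-map-strict (seen-step-mono p (game p t)) (prefix′ 0 z<s)
                                       (≤-reflexive (sym (seen-step-front p (game p t))))

    trapped-step : AdvancesAt t ⊎ (Trapped (suc t) × total t < total (suc t))
    trapped-step with suc j ≤? insertionIndex p (game p t)
    ... | yes j<q = inj₁ (trans (moveFront-< _ (deck (game p t)) j<q) card-at)
    ... | no  j≮q = inj₂ (stays-trapped (≰⇒> j≮q) , total-increases (≰⇒> j≮q))

  moves-forward : ∃[ u ] (N ≤ u × deck (game p u) j ≡ c)
  moves-forward with bounded-potential total total≤ trapped-step trapped-initially
  ... | t , N≤t , advanced = suc t , m≤n⇒m≤1+n N≤t , advanced

module _ (p : ℕ → ℕ) (unbounded : Unbounded p) where

  reaches-front : ∀ j {N c} → deck (game p N) j ≡ c → ∃[ t ] (N ≤ t × SeenAt p c t)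
  reaches-front zero    {N} at = N , ≤-refl , at
  reaches-front (suc j) at with Advance.moves-forward p unbounded at
  ... | u , N≤u , at′ with reaches-front j at′
  ...   | t , u≤t , seenAt = t , ≤-trans N≤u u≤t , seenAt

  unbounded⇒seenInfinitelyOften : EveryCardSeenInfinitelyOften p
  unbounded⇒seenInfinitelyOften c 1≤c N with card-in-deck p N c 1≤c
  ... | i , at = reaches-front i at

mainTheorem11 : (p : ℕ → ℕ) → (∀ k → 1 ≤ k → 1 ≤ p k) →
    (EveryCardSeenInfinitelyOften p ⇔ Unbounded p)
mainTheorem11 p _ = mk⇔ (seenInfinitelyOften⇒unbounded p) (unbounded⇒seenInfinitelyOften p)
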